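{- Let $T,S\subseteq\mathbb{Z}_{>0}$ be finite with $T\preceq S$. Then $T\triangleleft S\preceq S$.
   Context: For finite $T,S\subseteq\mathbb{Z}_{>0}$, $T\triangleleft S$ is computed by going through $s\in S$ from largest to smallest; each $s$ picks the largest not-yet-picked $t\in T$ with $t<s$, if one exists; $T\triangleleft S$ is the set of picked elements. $S(i)$ denotes the $i$-th smallest element of $S$. $T\preceq S$ means $|T|\ge|S|$ and $T(i)<S(i)$ for all $i\in[|S|]$. -}

module Defs where

open import Data.Nat using (ℕ; zero; suc; _<_; _≤_; _<ᵇ_; _⊔_; _≟_)
open import Data.List using (List; []; _∷_; length; lookup; filter; reverse)
open import Data.List.Relation.Unary.All using (All)
open import Data.List.Relation.Unary.Linked using (Linked)
open import Data.List.Membership.DecPropositional _≟_ using (_∈?_)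
open import Data.Maybe using (Maybe; just; nothing)
open import Data.Bool using (if_then_else_)
open import Data.Fin using (fromℕ<)
open import Data.Product using (_×_)
open import Relation.Nullary using (¬?)

-- A finite subset of ℤ_{>0} is represented by the list of its elements
-- in strictly increasing order, all positive.
IsFinPosSet : List ℕ → Set
IsFinPosSet xs = Linked _<_ xs × All (0 <_) xs

-- S(i) is the i-th smallest element (0-indexed here): lookup S i.
-- T ≼ S :  |T| ≥ |S|  and  T(i) < S(i) for all i ∈ [|S|].
_≼_ : List ℕ → List ℕ → Set
T ≼ S = (length S ≤ length T)
      × (∀ i (p : i < length S) (q : i < length T)
           → lookup T (fromℕ< q) < lookup S (fromℕ< p))

maxBelow : ℕ → List ℕ → Maybe ℕ
maxBelow s [] = nothing
maxBelow s (t ∷ ts) with maxBelow s ts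
... | nothing = if t <ᵇ s then just t else nothing
... | just m  = if t <ᵇ s then just (t ⊔ m) else just m

-- remove an element (lists are duplicate-free)
remove : ℕ → List ℕ → List ℕ
remove t = filter (λ x → ¬? (x ≟ t))

-- process elements of S (given largest first) against the still-unpicked
-- elements of T; returns the picked elements
pickAll : List ℕ → List ℕ → List ℕ
pickAll [] rem = []
pickAll (s ∷ ss) rem with maxBelow s rem
... | nothing = pickAll ss rem
... | just t  = t ∷ pickAll ss (remove t rem)

_◁_ : List ℕ → List ℕ → List ℕ
T ◁ S = filter (λ t → t ∈? pickAll (reverse S) T) T

{-# OPTIONS --safe #-}
module Submission where

-- For increasing lists, A ≼ S is equivalent to the counting condition A ≼ᶜ S: for every x,
-- at least as many elements of A lie below x as elements of S lie at or below x.  Greedy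
-- matching preserves it: once s has taken the largest available t < s, the rest of T still
-- satisfies it against the rest of S.  So every s is served, whatever the order in which S
-- is processed, and the picked elements alone satisfy the counting condition against S.

open import Defs
open import Data.Nat using (ℕ; zero; suc; _<_; _≤_; _>_; _<ᵇ_; _⊔_; _≟_; z≤n; s≤s; s≤s⁻¹; z<s)
open import Data.Nat.Properties
open import Data.List using (List; []; _∷_; length; filter; reverse)
open import Data.List.Properties using (filter-accept; filter-reject; filter-all; filter-none)
open import Data.List.Membership.Propositional using (_∈_)
open import Data.List.Membership.DecPropositional _≟_ using (_∈?_)
open import Data.List.Relation.Unary.All as All using (All; []; _∷_)
open import Data.List.Relation.Unary.AllPairs as AllPairs using (_∷_)
open import Data.List.Relation.Unary.Any using (here; there)
open import Data.List.Relation.Unary.Linked as Linked using (Linked)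
open import Data.List.Relation.Unary.Linked.Properties using (Linked⇒All; Linked⇒AllPairs)
import Data.List.Relation.Unary.Linked.Properties as Linked
open import Data.List.Relation.Unary.Unique.Propositional using (Unique)
import Data.List.Relation.Unary.Unique.Propositional.Properties as Unique
open import Data.List.Relation.Binary.Permutation.Propositional
  using (_↭_; ↭-sym; ↭-reflexive; refl; prep; swap; module PermutationReasoning)
open import Data.List.Relation.Binary.Permutation.Propositional.Properties
  using (↭-length; filter-↭; ↭-reverse)
open import Data.List.Relation.Binary.Sublist.Propositional using (_⊆_; _∷_; _∷ʳ_; ⊆-refl)
open import Data.List.Relation.Binary.Sublist.Propositional.Properties
  using (length-mono-≤)
import Data.List.Relation.Binary.Sublist.Propositional.Properties as Sublist
open import Data.List.Relation.Binary.Prefix.Heterogeneous using (Prefix; []; _∷_)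
open import Data.Maybe using (Maybe; just; nothing)
open import Data.Product using (_,_)
open import Data.Sum using (inj₁; inj₂)
open import Function using (_∘_)
open import Relation.Nullary using (¬_; ¬?; Dec; yes; no; contradiction)
open import Relation.Nullary.Reflects using (ofʸ; ofⁿ)
open import Relation.Unary using (Pred; Decidable)
open import Relation.Binary.PropositionalEquality using (_≡_; refl; sym; cong; subst; subst₂; module ≡-Reasoning)

module _ {A : Set} {p} {P : Pred A p} (P? : Decidable P) where

  count : List A → ℕ
  count xs = length (filter P? xs)

  count-accept : ∀ {x xs} → P x → count (x ∷ xs) ≡ suc (count xs)
  count-accept = cong length ∘ filter-accept P?

  count-reject : ∀ {x xs} → ¬ P x → count (x ∷ xs) ≡ count xs
  count-reject = cong length ∘ filter-reject P?

  count-resp-↭ : ∀ {xs ys} → xs ↭ ys → count xs ≡ count ys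
  count-resp-↭ = ↭-length ∘ filter-↭ P?

  count-mono-⊆ : ∀ {xs ys} → xs ⊆ ys → count xs ≤ count ys
  count-mono-⊆ = length-mono-≤ ∘ Sublist.filter⁺ P? P? (λ { refl px → px })

module _ {A : Set} {p q} {P : Pred A p} {Q : Pred A q} (P? : Decidable P) (Q? : Decidable Q) where

  count-mono : ∀ {xs} → (∀ {y} → y ∈ xs → P y → Q y) → count P? xs ≤ count Q? xs
  count-mono {[]}     _   = z≤n
  count-mono {y ∷ ys} P⇒Q with P? y | Q? y
  ... | yes _  | yes _  = s≤s (count-mono (P⇒Q ∘ there))
  ... | yes py | no ¬qy = contradiction (P⇒Q (here refl) py) ¬qy
  ... | no _   | yes _  = m≤n⇒m≤1+n (count-mono (P⇒Q ∘ there))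
  ... | no _   | no _   = count-mono (P⇒Q ∘ there)

  count-∷-mono : ∀ {x y xs ys} → (P x → Q y) → count P? xs ≤ count Q? ys →
                 count P? (x ∷ xs) ≤ count Q? (y ∷ ys)
  count-∷-mono {x} {y} Px⇒Qy le with P? x | Q? y
  ... | yes _  | yes _  = s≤s le
  ... | yes px | no ¬qy = contradiction (Px⇒Qy px) ¬qy
  ... | no _   | yes _  = m≤n⇒m≤1+n le
  ... | no _   | no _   = le

count<≡0 : ∀ {x xs} → All (x ≤_) xs → count (_<? x) xs ≡ 0
count<≡0 {x} = cong length ∘ filter-none (_<? x) ∘ All.map ≤⇒≯

↗-lowerBound : ∀ {x a as} → x ≤ a → Linked _<_ (a ∷ as) → All (x ≤_) (a ∷ as)
↗-lowerBound x≤a = Linked⇒All ≤-trans x≤a ∘ Linked.map <⇒≤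

↗-head< : ∀ {x a as} → Linked _<_ (a ∷ as) → 0 < count (_<? x) (a ∷ as) → a < x
↗-head< {x} {a} a∷as↗ pos with a <? x
... | yes a<x = a<x
... | no a≮x  = contradiction (count<≡0 (↗-lowerBound (≮⇒≥ a≮x) a∷as↗)) (>⇒≢ pos)

↗⇒Unique : ∀ {xs} → Linked _<_ xs → Unique xs
↗⇒Unique = AllPairs.map <⇒≢ ∘ Linked⇒AllPairs <-trans

≼⇒Prefix : ∀ A S → A ≼ S → Prefix _>_ S A
≼⇒Prefix A       []      _              = []
≼⇒Prefix []      (s ∷ S) (() , _)
≼⇒Prefix (a ∷ A) (s ∷ S) (s≤s len , lt) =
  lt 0 z<s z<s ∷ ≼⇒Prefix A S (len , λ i p q → lt (suc i) (s≤s p) (s≤s q))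

Prefix⇒≼ : ∀ {A S} → Prefix _>_ S A → A ≼ S
Prefix⇒≼ []          = z≤n , λ _ ()
Prefix⇒≼ (a<s ∷ S>A) with len , lt ← Prefix⇒≼ S>A =
  s≤s len , λ { zero _ _ → a<s ; (suc i) (s≤s p) (s≤s q) → lt i p q }

_≼ᶜ_ : List ℕ → List ℕ → Set
A ≼ᶜ S = ∀ x → count (_<? suc x) S ≤ count (_<? x) A

≼ᶜ-resp-↭ : ∀ {A S S′} → S ↭ S′ → A ≼ᶜ S → A ≼ᶜ S′
≼ᶜ-resp-↭ {A} {S} {S′} S↭S′ A≼S x =
  subst (_≤ count (_<? x) A) (count-resp-↭ (_<? suc x) S↭S′) (A≼S x)

≼ᶜ-∷⇒below : ∀ {A s S} → A ≼ᶜ (s ∷ S) → 0 < count (_<? s) A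
≼ᶜ-∷⇒below {s = s} A≼s∷S =
  <-≤-trans z<s (subst (_≤ _) (count-accept (_<? suc s) ≤-refl) (A≼s∷S s))

Prefix⇒≼ᶜ : ∀ {A S} → Linked _<_ S → Prefix _>_ S A → A ≼ᶜ S
Prefix⇒≼ᶜ _    []          x = z≤n
Prefix⇒≼ᶜ {S = s ∷ _} s∷S↗ (a<s ∷ S>A) x with s <? suc x
... | yes s≤x = subst₂ _≤_ (sym (count-accept (_<? suc x) s≤x))
                          (sym (count-accept (_<? x) (<-≤-trans a<s (s≤s⁻¹ s≤x))))
                          (s≤s (Prefix⇒≼ᶜ (Linked.tail s∷S↗) S>A x))
... | no s≰x = subst (_≤ _) (sym (count<≡0 (↗-lowerBound (≮⇒≥ s≰x) s∷S↗))) z≤n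

≼ᶜ⇒Prefix : ∀ {A S} → Linked _<_ A → Linked _<_ S → A ≼ᶜ S → Prefix _>_ S A
≼ᶜ⇒Prefix {S = []} _ _ _ = []
≼ᶜ⇒Prefix {[]} {s ∷ S} _ _ A≼S with () ← ≼ᶜ-∷⇒below {[]} {s} {S} A≼S
≼ᶜ⇒Prefix {a ∷ A} {s ∷ S} a∷A↗ s∷S↗ A≼S =
  a<s ∷ ≼ᶜ⇒Prefix (Linked.tail a∷A↗) (Linked.tail s∷S↗) tail≼
  where
  a<s : a < s
  a<s = ↗-head< a∷A↗ (≼ᶜ-∷⇒below {a ∷ A} {s} {S} A≼S)
  tail≼ : A ≼ᶜ S
  tail≼ x with s <? suc x
  ... | yes s≤x = s≤s⁻¹ (subst₂ _≤_ (count-accept (_<? suc x) s≤x)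
                                    (count-accept (_<? x) (<-≤-trans a<s (s≤s⁻¹ s≤x))) (A≼S x))
  ... | no s≰x = subst (_≤ _) (sym (count<≡0 (All.tail (↗-lowerBound (≮⇒≥ s≰x) s∷S↗)))) z≤n

data MaxBelow (s : ℕ) (L : List ℕ) : Maybe ℕ → Set where
  none : All (s ≤_) L → MaxBelow s L nothing
  some : ∀ {t} → t ∈ L → t < s → (∀ {y} → y ∈ L → y < s → y ≤ t) → MaxBelow s L (just t)

maxBelow-spec : ∀ s L → MaxBelow s L (maxBelow s L)
maxBelow-spec s [] = none []
maxBelow-spec s (t ∷ ts) with maxBelow s ts | maxBelow-spec s ts
... | nothing | none ts≥s with t <ᵇ s | <ᵇ-reflects-< t s
...   | _ | ofʸ t<s = some (here refl) t<s λ
        { (here refl) _ → ≤-refl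
        ; (there y∈ts) y<s → contradiction y<s (≤⇒≯ (All.lookup ts≥s y∈ts)) }
...   | _ | ofⁿ t≮s = none (≮⇒≥ t≮s ∷ ts≥s)
maxBelow-spec s (t ∷ ts) | just m | some m∈ts m<s m-max with t <ᵇ s | <ᵇ-reflects-< t s
...   | _ | ofʸ t<s = some t⊔m∈ (⊔-lub t<s m<s) λ
        { (here refl) _ → m≤m⊔n t m
        ; (there y∈ts) y<s → ≤-trans (m-max y∈ts y<s) (m≤n⊔m t m) }
  where
  t⊔m∈ : t ⊔ m ∈ t ∷ ts
  t⊔m∈ with ⊔-sel t m
  ... | inj₁ t⊔m≡t = here t⊔m≡t
  ... | inj₂ t⊔m≡m = there (subst (_∈ ts) (sym t⊔m≡m) m∈ts)
...   | _ | ofⁿ t≮s = some (there m∈ts) m<s λ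
        { (here refl) t<s → contradiction t<s t≮s
        ; (there y∈ts) → m-max y∈ts }

remove-↭ : ∀ {t L} → Unique L → t ∈ L → L ↭ t ∷ remove t L
remove-↭ {t} {t ∷ L} (t∉L ∷ _) (here refl) = prep t (↭-reflexive (sym (begin
  remove t (t ∷ L) ≡⟨ filter-reject (λ y → ¬? (y ≟ t)) (λ t≢t → t≢t refl) ⟩
  remove t L       ≡⟨ filter-all (λ y → ¬? (y ≟ t)) (All.map (λ t≢y → t≢y ∘ sym) t∉L) ⟩
  L                ∎)))
  where open ≡-Reasoning
remove-↭ {t} {y ∷ L} (y∉L ∷ L!) (there t∈L) = begin
  y ∷ L                ↭⟨ prep y (remove-↭ L! t∈L) ⟩
  y ∷ t ∷ remove t L   ↭⟨ swap y t refl ⟩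
  t ∷ y ∷ remove t L   ≡⟨ cong (t ∷_) (filter-accept (λ z → ¬? (z ≟ t)) (All.lookup y∉L t∈L)) ⟨
  t ∷ remove t (y ∷ L) ∎
  where open PermutationReasoning

count-remove : ∀ {p} {P : Pred ℕ p} (P? : Decidable P) {t L} → Unique L → t ∈ L →
               count P? L ≡ count P? (t ∷ remove t L)
count-remove P? L! t∈L = count-resp-↭ P? (remove-↭ L! t∈L)

remove-≼ᶜ : ∀ {s t L ss} → Unique L → MaxBelow s L (just t) → L ≼ᶜ (s ∷ ss) → remove t L ≼ᶜ ss
remove-≼ᶜ {s} {t} {L} {ss} L! (some t∈L t<s t-max) L≼ x = bound (t <? x) (s <? suc x)
  where
  open ≤-Reasoning
  L′ = remove t L

  bound : Dec (t < x) → Dec (s < suc x) → count (_<? suc x) ss ≤ count (_<? x) L′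
  bound (no t≮x) _ = begin
    count (_<? suc x) ss       ≤⟨ count-mono-⊆ (_<? suc x) (s ∷ʳ ⊆-refl) ⟩
    count (_<? suc x) (s ∷ ss) ≤⟨ L≼ x ⟩
    count (_<? x) L            ≡⟨ count-remove (_<? x) L! t∈L ⟩
    count (_<? x) (t ∷ L′)     ≡⟨ count-reject (_<? x) t≮x ⟩
    count (_<? x) L′           ∎
  bound (yes t<x) (yes s≤x) = s≤s⁻¹ (begin
    suc (count (_<? suc x) ss) ≡⟨ count-accept (_<? suc x) s≤x ⟨
    count (_<? suc x) (s ∷ ss) ≤⟨ L≼ x ⟩
    count (_<? x) L            ≡⟨ count-remove (_<? x) L! t∈L ⟩
    count (_<? x) (t ∷ L′)     ≡⟨ count-accept (_<? x) t<x ⟩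
    suc (count (_<? x) L′)     ∎)
  -- Here x < s, and every element of L below s is at most t, hence below x.
  bound (yes t<x) (no s≰x) = s≤s⁻¹ (begin
    suc (count (_<? suc x) ss) ≤⟨ s≤s (count-mono (_<? suc x) (_<? suc s) {ss}
                                     (λ _ y≤x → ≤-trans y≤x (m≤n⇒m≤1+n (≮⇒≥ s≰x)))) ⟩
    suc (count (_<? suc s) ss) ≡⟨ count-accept (_<? suc s) ≤-refl ⟨
    count (_<? suc s) (s ∷ ss) ≤⟨ L≼ s ⟩
    count (_<? s) L            ≤⟨ count-mono (_<? s) (_<? x) (λ y∈L y<s → ≤-<-trans (t-max y∈L y<s) t<x) ⟩
    count (_<? x) L            ≡⟨ count-remove (_<? x) L! t∈L ⟩
    count (_<? x) (t ∷ L′)     ≡⟨ count-accept (_<? x) t<x ⟩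
    suc (count (_<? x) L′)     ∎)

pickAll-≼ᶜ : ∀ ss L → Unique L → L ≼ᶜ ss → filter (_∈? pickAll ss L) L ≼ᶜ ss
pickAll-≼ᶜ []       L _  _  x = z≤n
pickAll-≼ᶜ (s ∷ ss) L L! L≼ with maxBelow s L | maxBelow-spec s L
... | nothing | none L≥s = contradiction (count<≡0 L≥s) (>⇒≢ (≼ᶜ-∷⇒below {L} {s} {ss} L≼))
... | just t | t-max@(some t∈L t<s _) = λ x → begin
  count (_<? suc x) (s ∷ ss)              ≤⟨ count-∷-mono (_<? suc x) (_<? x)
                                               (λ s≤x → <-≤-trans t<s (s≤s⁻¹ s≤x)) (ih x) ⟩
  count (_<? x) (t ∷ filter (_∈? Q) L′)   ≤⟨ count-mono-⊆ (_<? x) (refl ∷ Q-picked⊆P-picked) ⟩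
  count (_<? x) (t ∷ filter (_∈? P) L′)   ≡⟨ cong (count (_<? x)) (filter-accept (_∈? P) (here refl)) ⟨
  count (_<? x) (filter (_∈? P) (t ∷ L′)) ≡⟨ count-resp-↭ (_<? x) (filter-↭ (_∈? P) (remove-↭ L! t∈L)) ⟨
  count (_<? x) (filter (_∈? P) L)        ∎
  where
  open ≤-Reasoning
  L′ = remove t L
  Q = pickAll ss L′
  P = t ∷ Q
  ih : filter (_∈? Q) L′ ≼ᶜ ss
  ih = pickAll-≼ᶜ ss L′ (Unique.filter⁺ _ L!) (remove-≼ᶜ L! t-max L≼)
  Q-picked⊆P-picked : filter (_∈? Q) L′ ⊆ filter (_∈? P) L′
  Q-picked⊆P-picked = Sublist.filter⁺ (_∈? Q) (_∈? P) (λ { refl → there }) (⊆-refl {x = L′})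

corollary4p8 : (T S : List ℕ) → IsFinPosSet T → IsFinPosSet S →
    T ≼ S → (T ◁ S) ≼ S
corollary4p8 T S (T↗ , _) (S↗ , _) T≼S =
  Prefix⇒≼ (≼ᶜ⇒Prefix (Linked.filter⁺ _ <-trans T↗) S↗ T◁S≼ᶜS)
  where
  T≼ᶜS′ : T ≼ᶜ reverse S
  T≼ᶜS′ = ≼ᶜ-resp-↭ {T} (↭-sym (↭-reverse S)) (Prefix⇒≼ᶜ S↗ (≼⇒Prefix T S T≼S))
  T◁S≼ᶜS : (T ◁ S) ≼ᶜ S
  T◁S≼ᶜS = ≼ᶜ-resp-↭ {T ◁ S} (↭-reverse S) (pickAll-≼ᶜ (reverse S) T (↗⇒Unique T↗) T≼ᶜS′)
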